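{- Let $M=(X,rk)$ be a matroid of rank $r=rk(X)$. Then for every integer $j>f_2(M)-r$, \[ [y^j]\,T_M(1,y)=\binom{|X|-j-1}{r-1}-\sum_{\substack{H\in\mathcal{H}(M)\\ |H|>f_2(M)}}\binom{|H|-j-1}{r-1}. \] Equivalently, \[ [y^j]\,T_M(1,y)=\binom{|X|-j-1}{r-1}-\sum_{\substack{C\in\mathcal{C}^*(M)\\ |C|<|X|-f_2(M)}}\binom{|X|-|C|-j-1}{r-1}. \]
   Context: For a matroid $M=(X,rk)$ with $r=rk(X)$, the Tutte polynomial is $T_M(x,y)=\sum_{A\subseteq X}(x-1)^{r-rk(A)}(y-1)^{|A|-rk(A)}$, and $[y^j]f(y)$ denotes the coefficient of $y^j$ in a polynomial $f$. The closure of $A\subseteq X$ is $cl_M(A)=\{e\in X: rk(A\cup\{e\})=rk(A)\}$; a flat is a set $F$ with $cl_M(F)=F$; a hyperplane is a flat of rank $r-1$, and $\mathcal{H}(M)$ is the set of all hyperplanes of $M$. For $k\ge1$, $f_k(M)=\max\{|F|: F \text{ a flat of } M,\ rk(F)=r-k\}$. $\mathcal{C}^*(M)$ denotes the set of cocircuits of $M$ (circuits of the dual matroid $M^*$, equivalently complements of hyperplanes). -}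

module Defs where

open import Data.Bool using (Bool; true; false; _∧_; _∨_; not; if_then_else_)
open import Data.Nat as ℕ using (ℕ; zero; suc; _∸_; _≤_; _<_; _⊔_; _≡ᵇ_; _<ᵇ_)
open import Data.Nat.Combinatorics using (_C_)
open import Data.Integer as ℤ using (ℤ; +_; -[1+_])
open import Data.List as List using (List; []; _∷_; map; foldr; filterᵇ; _++_)
open import Data.Vec as Vec using (Vec; []; _∷_; tabulate)
open import Data.Vec.Properties using (≡-dec)
open import Data.Fin using (Fin)
open import Data.Fin.Subset using (Subset; _∪_; _∩_; _─_; ∁; ⁅_⁆; ∣_∣; ⊤; ⊥; _⊆_; _⊂_)
open import Data.Fin.Subset.Properties using (_⊂?_)
import Data.Bool.Properties as BoolP
open import Relation.Nullary.Decidable using (⌊_⌋; Dec)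
open import Relation.Binary.PropositionalEquality using (_≡_)

-- Univariate / bivariate polynomials as coefficient lists (lowest first)

module PolyOps {A : Set} (0# : A) (_⊕_ _⊗_ : A → A → A) where
  Poly : Set
  Poly = List A

  _+P_ : Poly → Poly → Poly
  []       +P q        = q
  (a ∷ p)  +P []       = a ∷ p
  (a ∷ p)  +P (b ∷ q)  = (a ⊕ b) ∷ (p +P q)

  scale : A → Poly → Poly
  scale a = map (a ⊗_)

  _*P_ : Poly → Poly → Poly
  []      *P q = []
  (a ∷ p) *P q = scale a q +P (0# ∷ (p *P q))

  powP : Poly → Poly → ℕ → Poly
  powP one p zero    = one
  powP one p (suc k) = p *P powP one p k

  sumP : List Poly → Poly
  sumP = foldr _+P_ []

open PolyOps (+ 0) ℤ._+_ ℤ._*_ public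
  renaming (Poly to ℤ[y]; _+P_ to _+y_; _*P_ to _*y_; powP to powY; sumP to sumY)

oneY : ℤ[y]
oneY = + 1 ∷ []

y-1 : ℤ[y]
y-1 = -[1+ 0 ] ∷ + 1 ∷ []

_^y_ : ℤ[y] → ℕ → ℤ[y]
p ^y k = powY oneY p k

coeff : ℤ[y] → ℕ → ℤ
coeff []      j       = + 0
coeff (a ∷ p) zero    = a
coeff (a ∷ p) (suc j) = coeff p j

-- ℤ[y][x] : polynomials in x with coefficients in ℤ[y]
module Bi = PolyOps {ℤ[y]} [] _+y_ _*y_

ℤ[x,y] : Set
ℤ[x,y] = Bi.Poly

constX : ℤ[y] → ℤ[x,y]
constX p = p ∷ []

x-1 : ℤ[x,y]
x-1 = constX (-[1+ 0 ] ∷ []) Bi.+P ([] ∷ oneY ∷ [])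

_^x_ : ℤ[x,y] → ℕ → ℤ[x,y]
p ^x k = Bi.powP (constX oneY) p k

evalX1 : ℤ[x,y] → ℤ[y]
evalX1 = foldr _+y_ []

allSubsets : (n : ℕ) → List (Subset n)
allSubsets zero    = [] ∷ []
allSubsets (suc n) = map (false ∷_) (allSubsets n) ++ map (true ∷_) (allSubsets n)

_≟S_ : ∀ {n} (A B : Subset n) → Dec (A ≡ B)
_≟S_ = ≡-dec BoolP._≟_

record Matroid (n : ℕ) : Set where
  field
    rk        : Subset n → ℕ
    rk-bound  : ∀ A → rk A ≤ ∣ A ∣
    rk-mono   : ∀ {A B} → A ⊆ B → rk A ≤ rk B
    rk-submod : ∀ A B → rk (A ∪ B) ℕ.+ rk (A ∩ B) ≤ rk A ℕ.+ rk B

module _ {n : ℕ} (M : Matroid n) where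
  open Matroid M

  rank : ℕ
  rank = rk ⊤

  cl : Subset n → Subset n
  cl A = tabulate (λ e → ⌊ rk (A ∪ ⁅ e ⁆) ℕ.≟ rk A ⌋)

  IsFlat : Subset n → Set
  IsFlat F = cl F ≡ F

  isFlatᵇ : Subset n → Bool
  isFlatᵇ F = ⌊ cl F ≟S F ⌋

  flatsOfRank : ℕ → List (Subset n)
  flatsOfRank k = filterᵇ (λ F → isFlatᵇ F ∧ (rk F ≡ᵇ k)) (allSubsets n)

  hyperplanes : List (Subset n)
  hyperplanes = flatsOfRank (rank ∸ 1)

  -- f_k(M) = max { |F| : F flat, rk F = r - k }  (meaningful for k ≤ r)
  f : ℕ → ℕ
  f k = foldr _⊔_ 0 (map ∣_∣ (flatsOfRank (rank ∸ k)))

  rk* : Subset n → ℕ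
  rk* A = (∣ A ∣ ℕ.+ rk (∁ A)) ∸ rank

  isCocircuitᵇ : Subset n → Bool
  isCocircuitᵇ C =
    (rk* C <ᵇ ∣ C ∣) ∧
    foldr (λ B b → (not ⌊ B ⊂? C ⌋ ∨ (rk* B ≡ᵇ ∣ B ∣)) ∧ b) true (allSubsets n)

  cocircuits : List (Subset n)
  cocircuits = filterᵇ isCocircuitᵇ (allSubsets n)

  tutte : ℤ[x,y]
  tutte = Bi.sumP (map (λ A → (x-1 ^x (rank ∸ rk A)) Bi.*P constX (y-1 ^y (∣ A ∣ ∸ rk A)))
                       (allSubsets n))

-- Binomial coefficient with integer top: C(m,k) = 0 when m < 0

binomℤ : ℤ → ℕ → ℤ
binomℤ (+ m)    k = + (m C k)
binomℤ -[1+ _ ] k = + 0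

sumℤ : List ℤ → ℤ
sumℤ = foldr ℤ._+_ (+ 0)

-- At x = 1 only spanning sets survive in T_M, so [y^j] T_M(1, y) = Σ w(A) over spanning A, where
-- w(A) = [y^j] (y − 1)^(|A| − r).  Extend w by w(A) = 0 for |A| < r; it also vanishes for |A| < r + j.
-- If |A| ≥ r + j > f₂(M) and A does not span, then A lies in a unique hyperplane with more than
-- f₂(M) elements: A lies in some hyperplane, and two distinct hyperplanes meet in a set of rank at
-- most r − 2, which has at most f₂(M) elements.  Hence
--   [y^j] T_M(1, y) = Σ_{A ⊆ X} w(A) − Σ_{H large} Σ_{A ⊆ H} w(A),
-- and Σ_{A ⊆ S} w(A) = Σ_k C(|S|, k) [y^j] (y − 1)^(k − r) = C(|S| − j − 1, r − 1) by Pascal's rule.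
-- The cocircuit form is the same sum indexed by complements, since the cocircuits are exactly the
-- complements of the hyperplanes.

module Submission where

open import Defs
open import Data.Nat as ℕ using (ℕ; zero; suc; _≤_; _<_; _∸_; _<ᵇ_; _≡ᵇ_; _⊔_; z≤n; s≤s; z<s)
import Data.Nat.Properties as ℕₚ
open import Data.Nat.Combinatorics using (_C_; nCk+nC[k+1]≡[n+1]C[k+1])
open import Data.Integer as ℤ using (ℤ; +_; -[1+_]; _+_; _*_; -_; _-_; _>_; _⊖_)
import Data.Integer.Properties as ℤₚ
open import Data.Integer.Tactic.RingSolver using (solve-∀)
open import Data.List using (List; []; _∷_; map; foldr; filterᵇ; _++_; allFin)
open import Data.List.Properties using (foldr-map)
open import Data.List.Membership.Propositional using () renaming (_∈_ to _∈ˡ_)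
open import Data.List.Membership.Propositional.Properties
  using (∈-filter⁺; ∈-filter⁻; ∈-allFin; ∈-map⁺; ∈-map⁻; ∈-++⁺ˡ; ∈-++⁺ʳ)
open import Data.List.Relation.Unary.Any using (here; there)
open import Data.List.Relation.Unary.All as All using (All; [])
import Data.List.Relation.Unary.All.Properties as All
open import Data.List.Relation.Unary.AllPairs using ([]; _∷_)
open import Data.List.Relation.Unary.Unique.Propositional using (Unique)
import Data.List.Relation.Unary.Unique.Propositional.Properties as Unique
open import Data.Bool using (Bool; true; false; T; T?; _∧_; _∨_; not; if_then_else_)
open import Data.Bool.Properties using (T-≡; T-∧; if-eta; if-cong-then)
open import Data.Vec using ([]; _∷_)
open import Data.Vec.Properties using (lookup∘tabulate; []=⇒lookup; lookup⇒[]=)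
open import Data.Fin using (Fin)
import Data.Fin.Properties as Finₚ
open import Data.Fin.Subset using (Subset; ∣_∣; _∈_; _∉_; _⊆_; _⊂_; _∪_; _∩_; ⁅_⁆; ⊤; ∁)
import Data.Fin.Subset.Properties as SP
import Algebra.Lattice.Properties.BooleanAlgebra as BooleanAlgebra
open import Data.Product using (_×_; _,_; ∃; proj₁; proj₂)
open import Data.Sum using (_⊎_; inj₁; inj₂)
open import Data.Empty using (⊥-elim)
open import Function using (_∘_; id)
open import Function.Bundles using (Equivalence)
open import Relation.Nullary using (¬_; does; yes; no)
open import Relation.Nullary.Decidable using (⌊_⌋; toWitness; fromWitness)
open import Relation.Unary using (Decidable)
open import Relation.Binary.PropositionalEquality

sumMap : {A : Set} → List A → (A → ℤ) → ℤ
sumMap xs f = sumℤ (map f xs)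

sumMap-++ : ∀ {A : Set} (xs ys : List A) f → sumMap (xs ++ ys) f ≡ sumMap xs f + sumMap ys f
sumMap-++ []       ys f = sym (ℤₚ.+-identityˡ _)
sumMap-++ (x ∷ xs) ys f = trans (cong (_+_ (f x)) (sumMap-++ xs ys f)) (sym (ℤₚ.+-assoc (f x) _ _))

sumMap-map : ∀ {A B : Set} (g : A → B) (xs : List A) f → sumMap (map g xs) f ≡ sumMap xs (f ∘ g)
sumMap-map g []       f = refl
sumMap-map g (x ∷ xs) f = cong (_+_ (f (g x))) (sumMap-map g xs f)

sumMap-cong : ∀ {A : Set} (xs : List A) {f g : A → ℤ} → (∀ {x} → x ∈ˡ xs → f x ≡ g x) →
              sumMap xs f ≡ sumMap xs g
sumMap-cong []       f≗g = refl
sumMap-cong (x ∷ xs) f≗g = cong₂ _+_ (f≗g (here refl)) (sumMap-cong xs (f≗g ∘ there))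

sumMap-zero : ∀ {A : Set} (xs : List A) {f : A → ℤ} → (∀ {x} → x ∈ˡ xs → f x ≡ + 0) → sumMap xs f ≡ + 0
sumMap-zero xs f≗0 = trans (sumMap-cong xs f≗0) (sumMap-const0 xs)
  where
  sumMap-const0 : ∀ {A : Set} (xs : List A) → sumMap xs (λ _ → + 0) ≡ + 0
  sumMap-const0 []       = refl
  sumMap-const0 (_ ∷ xs) = trans (ℤₚ.+-identityˡ _) (sumMap-const0 xs)

sumMap-+ : ∀ {A : Set} (xs : List A) f g → sumMap xs (λ x → f x + g x) ≡ sumMap xs f + sumMap xs g
sumMap-+ []       f g = refl
sumMap-+ (x ∷ xs) f g = trans (cong (_+_ (f x + g x)) (sumMap-+ xs f g)) (interchange (f x) (g x) _ _)
  where
  interchange : ∀ a b c d → a + b + (c + d) ≡ (a + c) + (b + d)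
  interchange = solve-∀

sumMap-neg : ∀ {A : Set} (xs : List A) f → sumMap xs (λ x → - f x) ≡ - sumMap xs f
sumMap-neg []       f = refl
sumMap-neg (x ∷ xs) f = trans (cong (_+_ (- f x)) (sumMap-neg xs f)) (sym (ℤₚ.neg-distrib-+ (f x) _))

sumMap-- : ∀ {A : Set} (xs : List A) f g → sumMap xs (λ x → f x - g x) ≡ sumMap xs f - sumMap xs g
sumMap-- xs f g = trans (sumMap-+ xs f (λ x → - g x)) (cong (_+_ (sumMap xs f)) (sumMap-neg xs g))

sumMap-comm : ∀ {A B : Set} (xs : List A) (ys : List B) (g : A → B → ℤ) →
              sumMap xs (λ x → sumMap ys (g x)) ≡ sumMap ys (λ y → sumMap xs (λ x → g x y))
sumMap-comm []       ys g = sym (sumMap-zero ys (λ _ → refl))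
sumMap-comm (x ∷ xs) ys g = trans (cong (_+_ (sumMap ys (g x))) (sumMap-comm xs ys g))
                                  (sym (sumMap-+ ys (g x) (λ y → sumMap xs (λ x → g x y))))

sumMap-filterᵇ : ∀ {A : Set} (p : A → Bool) (xs : List A) f →
                 sumMap (filterᵇ p xs) f ≡ sumMap xs (λ x → if p x then f x else + 0)
sumMap-filterᵇ p []       f = refl
sumMap-filterᵇ p (x ∷ xs) f with p x
... | true  = cong (_+_ (f x)) (sumMap-filterᵇ p xs f)
... | false = trans (sumMap-filterᵇ p xs f) (sym (ℤₚ.+-identityˡ _))

sumMap-indicator-none : ∀ {A : Set} {P : A → Set} (P? : Decidable P) (xs : List A) (v : ℤ) →
                        (∀ {x} → x ∈ˡ xs → ¬ P x) →
                        sumMap xs (λ x → if does (P? x) then v else + 0) ≡ + 0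
sumMap-indicator-none P? xs v ¬P = sumMap-zero xs indicator≡0
  where
  indicator≡0 : ∀ {x} → x ∈ˡ xs → (if does (P? x) then v else + 0) ≡ + 0
  indicator≡0 {x} x∈xs with P? x
  ... | yes Px = ⊥-elim (¬P x∈xs Px)
  ... | no  _  = refl

sumMap-indicator-unique : ∀ {A : Set} {P : A → Set} (P? : Decidable P) {xs : List A} (v : ℤ) →
                          Unique xs → ∀ {x₀} → x₀ ∈ˡ xs → P x₀ → (∀ {x} → x ∈ˡ xs → P x → x ≡ x₀) →
                          sumMap xs (λ x → if does (P? x) then v else + 0) ≡ v
sumMap-indicator-unique {P = P} P? v (x∉xs ∷ xs!) {x₀} (here refl) Px₀ unique with P? x₀
... | no ¬Px₀ = ⊥-elim (¬Px₀ Px₀)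
... | yes _   = trans (cong (_+_ v) (sumMap-indicator-none P? _ v ¬P)) (ℤₚ.+-identityʳ v)
  where
  ¬P : ∀ {x} → x ∈ˡ _ → ¬ P x
  ¬P x∈xs Px = All.lookup x∉xs x∈xs (sym (unique (there x∈xs) Px))
sumMap-indicator-unique P? {x ∷ xs} v (x∉xs ∷ xs!) (there x₀∈xs) Px₀ unique with P? x
... | yes Px = ⊥-elim (All.lookup x∉xs x₀∈xs (unique (here refl) Px))
... | no  _  = trans (ℤₚ.+-identityˡ _) (sumMap-indicator-unique P? v xs! x₀∈xs Px₀ (unique ∘ there))

∈-filterᵇ⁻ : ∀ {A : Set} (p : A → Bool) {x xs} → x ∈ˡ filterᵇ p xs → x ∈ˡ xs × T (p x)
∈-filterᵇ⁻ p = ∈-filter⁻ (T? ∘ p)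

∈-filterᵇ⁺ : ∀ {A : Set} (p : A → Bool) {x xs} → x ∈ˡ xs → T (p x) → x ∈ˡ filterᵇ p xs
∈-filterᵇ⁺ p = ∈-filter⁺ (T? ∘ p)

T-foldr-∧⁻ : ∀ {A : Set} (p : A → Bool) xs → T (foldr (λ x b → p x ∧ b) true xs) → All (T ∘ p) xs
T-foldr-∧⁻ p xs = All.all⁺ p xs ∘ subst T (sym (foldr-map _∧_ p true xs))

T-foldr-∧⁺ : ∀ {A : Set} (p : A → Bool) xs → All (T ∘ p) xs → T (foldr (λ x b → p x ∧ b) true xs)
T-foldr-∧⁺ p xs = subst T (foldr-map _∧_ p true xs) ∘ All.all⁻ p

coeff-+y : ∀ p q j → coeff (p +y q) j ≡ coeff p j + coeff q j
coeff-+y []      q       j       = sym (ℤₚ.+-identityˡ _)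
coeff-+y (a ∷ p) []      j       = sym (ℤₚ.+-identityʳ _)
coeff-+y (a ∷ p) (b ∷ q) zero    = refl
coeff-+y (a ∷ p) (b ∷ q) (suc j) = coeff-+y p q j

coeff-scale : ∀ a p j → coeff (scale a p) j ≡ a * coeff p j
coeff-scale a []      j       = sym (ℤₚ.*-zeroʳ a)
coeff-scale a (b ∷ p) zero    = refl
coeff-scale a (b ∷ p) (suc j) = coeff-scale a p j

coeff-∷*y-zero : ∀ a p q → coeff ((a ∷ p) *y q) 0 ≡ a * coeff q 0
coeff-∷*y-zero a p q = begin
  coeff (scale a q +y (+ 0 ∷ (p *y q))) 0 ≡⟨ coeff-+y (scale a q) _ 0 ⟩
  coeff (scale a q) 0 + + 0               ≡⟨ ℤₚ.+-identityʳ _ ⟩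
  coeff (scale a q) 0                     ≡⟨ coeff-scale a q 0 ⟩
  a * coeff q 0                           ∎
  where open ≡-Reasoning

coeff-∷*y-suc : ∀ a p q j → coeff ((a ∷ p) *y q) (suc j) ≡ a * coeff q (suc j) + coeff (p *y q) j
coeff-∷*y-suc a p q j =
  trans (coeff-+y (scale a q) _ (suc j)) (cong (_+ coeff (p *y q) j) (coeff-scale a q (suc j)))

coeff-const*y : ∀ c q j → coeff ((c ∷ []) *y q) j ≡ c * coeff q j
coeff-const*y c q zero    = coeff-∷*y-zero c [] q
coeff-const*y c q (suc j) = trans (coeff-∷*y-suc c [] q j) (ℤₚ.+-identityʳ _)

coeff-*y-distribʳ : ∀ p p′ q j → coeff ((p +y p′) *y q) j ≡ coeff (p *y q) j + coeff (p′ *y q) j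
coeff-*y-distribʳ []      p′       q j       = sym (ℤₚ.+-identityˡ _)
coeff-*y-distribʳ (a ∷ p) []       q j       = sym (ℤₚ.+-identityʳ _)
coeff-*y-distribʳ (a ∷ p) (b ∷ p′) q zero    = begin
  coeff (((a + b) ∷ (p +y p′)) *y q) 0              ≡⟨ coeff-∷*y-zero (a + b) (p +y p′) q ⟩
  (a + b) * coeff q 0                               ≡⟨ ℤₚ.*-distribʳ-+ (coeff q 0) a b ⟩
  a * coeff q 0 + b * coeff q 0
    ≡⟨ cong₂ _+_ (coeff-∷*y-zero a p q) (coeff-∷*y-zero b p′ q) ⟨
  coeff ((a ∷ p) *y q) 0 + coeff ((b ∷ p′) *y q) 0  ∎
  where open ≡-Reasoning
coeff-*y-distribʳ (a ∷ p) (b ∷ p′) q (suc j) = begin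
  coeff (((a + b) ∷ (p +y p′)) *y q) (suc j)
    ≡⟨ coeff-∷*y-suc (a + b) (p +y p′) q j ⟩
  (a + b) * coeff q (suc j) + coeff ((p +y p′) *y q) j
    ≡⟨ cong (_+_ ((a + b) * coeff q (suc j))) (coeff-*y-distribʳ p p′ q j) ⟩
  (a + b) * coeff q (suc j) + (coeff (p *y q) j + coeff (p′ *y q) j)
    ≡⟨ regroup a b (coeff q (suc j)) _ _ ⟩
  (a * coeff q (suc j) + coeff (p *y q) j) + (b * coeff q (suc j) + coeff (p′ *y q) j)
    ≡⟨ cong₂ _+_ (coeff-∷*y-suc a p q j) (coeff-∷*y-suc b p′ q j) ⟨
  coeff ((a ∷ p) *y q) (suc j) + coeff ((b ∷ p′) *y q) (suc j)
    ∎
  where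
  open ≡-Reasoning
  regroup : ∀ a b x u v → (a + b) * x + (u + v) ≡ (a * x + u) + (b * x + v)
  regroup = solve-∀

coeff-*y-zeroˡ : ∀ p q → (∀ i → coeff p i ≡ + 0) → ∀ j → coeff (p *y q) j ≡ + 0
coeff-*y-zeroˡ []      q p≈0 j       = refl
coeff-*y-zeroˡ (a ∷ p) q p≈0 zero    = trans (coeff-∷*y-zero a p q) (cong (_* coeff q 0) (p≈0 0))
coeff-*y-zeroˡ (a ∷ p) q p≈0 (suc j) =
  trans (coeff-∷*y-suc a p q j)
        (cong₂ (λ a′ r → a′ * coeff q (suc j) + r) (p≈0 0) (coeff-*y-zeroˡ p q (p≈0 ∘ suc) j))

coeff-evalX1-+ : ∀ P Q j → coeff (evalX1 (P Bi.+P Q)) j ≡ coeff (evalX1 P) j + coeff (evalX1 Q) j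
coeff-evalX1-+ []      Q       j = sym (ℤₚ.+-identityˡ _)
coeff-evalX1-+ (a ∷ P) []      j = sym (ℤₚ.+-identityʳ _)
coeff-evalX1-+ (a ∷ P) (b ∷ Q) j = begin
  coeff ((a +y b) +y evalX1 (P Bi.+P Q)) j
    ≡⟨ coeff-+y (a +y b) _ j ⟩
  coeff (a +y b) j + coeff (evalX1 (P Bi.+P Q)) j
    ≡⟨ cong₂ _+_ (coeff-+y a b j) (coeff-evalX1-+ P Q j) ⟩
  (coeff a j + coeff b j) + (coeff (evalX1 P) j + coeff (evalX1 Q) j)
    ≡⟨ interchange (coeff a j) (coeff b j) _ _ ⟩
  (coeff a j + coeff (evalX1 P) j) + (coeff b j + coeff (evalX1 Q) j)
    ≡⟨ cong₂ _+_ (coeff-+y a (evalX1 P) j) (coeff-+y b (evalX1 Q) j) ⟨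
  coeff (a +y evalX1 P) j + coeff (b +y evalX1 Q) j
    ∎
  where
  open ≡-Reasoning
  interchange : ∀ a b c d → (a + b) + (c + d) ≡ (a + c) + (b + d)
  interchange = solve-∀

coeff-evalX1-sumP : ∀ Ps j → coeff (evalX1 (Bi.sumP Ps)) j ≡ sumMap Ps (λ P → coeff (evalX1 P) j)
coeff-evalX1-sumP []       j = refl
coeff-evalX1-sumP (P ∷ Ps) j =
  trans (coeff-evalX1-+ P (Bi.sumP Ps) j) (cong (_+_ (coeff (evalX1 P) j)) (coeff-evalX1-sumP Ps j))

coeff-evalX1-scale : ∀ c P j → coeff (evalX1 (Bi.scale (c ∷ []) P)) j ≡ c * coeff (evalX1 P) j
coeff-evalX1-scale c []      j = sym (ℤₚ.*-zeroʳ c)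
coeff-evalX1-scale c (a ∷ P) j = begin
  coeff (((c ∷ []) *y a) +y evalX1 (Bi.scale (c ∷ []) P)) j
    ≡⟨ coeff-+y ((c ∷ []) *y a) _ j ⟩
  coeff ((c ∷ []) *y a) j + coeff (evalX1 (Bi.scale (c ∷ []) P)) j
    ≡⟨ cong₂ _+_ (coeff-const*y c a j) (coeff-evalX1-scale c P j) ⟩
  c * coeff a j + c * coeff (evalX1 P) j
    ≡⟨ ℤₚ.*-distribˡ-+ c _ _ ⟨
  c * (coeff a j + coeff (evalX1 P) j)
    ≡⟨ cong (c *_) (coeff-+y a (evalX1 P) j) ⟨
  c * coeff (a +y evalX1 P) j
    ∎
  where open ≡-Reasoning

coeff-evalX1-x-1*P : ∀ P j → coeff (evalX1 (x-1 Bi.*P P)) j ≡ + 0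
coeff-evalX1-x-1*P P j = begin
  coeff (evalX1 (Bi.scale (-[1+ 0 ] ∷ []) P Bi.+P ([] ∷ (Bi.scale oneY P Bi.+P ([] ∷ []))))) j
    ≡⟨ coeff-evalX1-+ (Bi.scale (-[1+ 0 ] ∷ []) P) _ j ⟩
  coeff (evalX1 (Bi.scale (-[1+ 0 ] ∷ []) P)) j + coeff (evalX1 (Bi.scale oneY P Bi.+P ([] ∷ []))) j
    ≡⟨ cong₂ _+_ (coeff-evalX1-scale -[1+ 0 ] P j) (coeff-evalX1-+ (Bi.scale oneY P) ([] ∷ []) j) ⟩
  -[1+ 0 ] * coeff (evalX1 P) j + (coeff (evalX1 (Bi.scale oneY P)) j + + 0)
    ≡⟨ cong (λ e → -[1+ 0 ] * coeff (evalX1 P) j + (e + + 0)) (coeff-evalX1-scale (+ 1) P j) ⟩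
  -[1+ 0 ] * coeff (evalX1 P) j + (+ 1 * coeff (evalX1 P) j + + 0)
    ≡⟨ cancel (coeff (evalX1 P) j) ⟩
  + 0
    ∎
  where
  open ≡-Reasoning
  cancel : ∀ a → -[1+ 0 ] * a + (+ 1 * a + + 0) ≡ + 0
  cancel = solve-∀

coeff-evalX1-*constX : ∀ P q j → coeff (evalX1 (P Bi.*P constX q)) j ≡ coeff (evalX1 P *y q) j
coeff-evalX1-*constX []      q j = refl
coeff-evalX1-*constX (a ∷ P) q j = begin
  coeff (((a *y q) +y []) +y evalX1 (P Bi.*P constX q)) j
    ≡⟨ coeff-+y ((a *y q) +y []) _ j ⟩
  coeff ((a *y q) +y []) j + coeff (evalX1 (P Bi.*P constX q)) j
    ≡⟨ cong₂ _+_ (trans (coeff-+y (a *y q) [] j) (ℤₚ.+-identityʳ (coeff (a *y q) j)))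
                 (coeff-evalX1-*constX P q j) ⟩
  coeff (a *y q) j + coeff (evalX1 P *y q) j
    ≡⟨ coeff-*y-distribʳ a (evalX1 P) q j ⟨
  coeff ((a +y evalX1 P) *y q) j
    ∎
  where open ≡-Reasoning

coeff-evalX1-[x-1]^0*constX : ∀ q j → coeff (evalX1 ((x-1 ^x 0) Bi.*P constX q)) j ≡ coeff q j
coeff-evalX1-[x-1]^0*constX q j =
  trans (coeff-evalX1-*constX (constX oneY) q j) (trans (coeff-const*y (+ 1) q j) (ℤₚ.*-identityˡ _))

coeff-evalX1-[x-1]^k*constX : ∀ {k} q j → 0 < k → coeff (evalX1 ((x-1 ^x k) Bi.*P constX q)) j ≡ + 0
coeff-evalX1-[x-1]^k*constX {suc k} q j _ =
  trans (coeff-evalX1-*constX (x-1 ^x suc k) q j)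
        (coeff-*y-zeroˡ (evalX1 (x-1 ^x suc k)) q (coeff-evalX1-x-1*P (x-1 ^x k)) j)

coeff-[y-1]^suc-zero : ∀ k → coeff (y-1 ^y suc k) 0 ≡ - coeff (y-1 ^y k) 0
coeff-[y-1]^suc-zero k = trans (coeff-∷*y-zero -[1+ 0 ] (+ 1 ∷ []) (y-1 ^y k)) (ℤₚ.-1*i≡-i _)

coeff-[y-1]^suc-suc : ∀ k j → coeff (y-1 ^y suc k) (suc j) ≡ coeff (y-1 ^y k) j - coeff (y-1 ^y k) (suc j)
coeff-[y-1]^suc-suc k j = begin
  coeff (y-1 *y (y-1 ^y k)) (suc j)
    ≡⟨ coeff-∷*y-suc -[1+ 0 ] (+ 1 ∷ []) (y-1 ^y k) j ⟩
  -[1+ 0 ] * coeff (y-1 ^y k) (suc j) + coeff ((+ 1 ∷ []) *y (y-1 ^y k)) j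
    ≡⟨ cong (_+_ (-[1+ 0 ] * coeff (y-1 ^y k) (suc j))) (coeff-const*y (+ 1) (y-1 ^y k) j) ⟩
  -[1+ 0 ] * coeff (y-1 ^y k) (suc j) + + 1 * coeff (y-1 ^y k) j
    ≡⟨ swap-sub (coeff (y-1 ^y k) (suc j)) (coeff (y-1 ^y k) j) ⟩
  coeff (y-1 ^y k) j - coeff (y-1 ^y k) (suc j)
    ∎
  where
  open ≡-Reasoning
  swap-sub : ∀ a b → -[1+ 0 ] * a + + 1 * b ≡ b - a
  swap-sub = solve-∀

coeff-[y-1]^-> : ∀ {k j} → k < j → coeff (y-1 ^y k) j ≡ + 0
coeff-[y-1]^-> {zero}  {suc j} _         = refl
coeff-[y-1]^-> {suc k} {suc j} (s≤s k<j) =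
  trans (coeff-[y-1]^suc-suc k j)
        (cong₂ _-_ (coeff-[y-1]^-> k<j) (coeff-[y-1]^-> (ℕₚ.m<n⇒m<1+n k<j)))

-- Binomial sums

-- binomialSum m g = Σₖ C(m, k) · g k
binomialSum : ℕ → (ℕ → ℤ) → ℤ
binomialSum zero    g = g 0
binomialSum (suc m) g = binomialSum m g + binomialSum m (g ∘ suc)

binomialSum-cong : ∀ m {g h : ℕ → ℤ} → (∀ k → g k ≡ h k) → binomialSum m g ≡ binomialSum m h
binomialSum-cong zero    g≗h = g≗h 0
binomialSum-cong (suc m) g≗h = cong₂ _+_ (binomialSum-cong m g≗h) (binomialSum-cong m (g≗h ∘ suc))

binomialSum-neg : ∀ m g → binomialSum m (λ k → - g k) ≡ - binomialSum m g
binomialSum-neg zero    g = refl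
binomialSum-neg (suc m) g =
  trans (cong₂ _+_ (binomialSum-neg m g) (binomialSum-neg m (g ∘ suc)))
        (sym (ℤₚ.neg-distrib-+ (binomialSum m g) _))

binomialSum-- : ∀ m g h → binomialSum m (λ k → g k - h k) ≡ binomialSum m g - binomialSum m h
binomialSum-- zero    g h = refl
binomialSum-- (suc m) g h =
  trans (cong₂ _+_ (binomialSum-- m g h) (binomialSum-- m (g ∘ suc) (h ∘ suc)))
        (interchange (binomialSum m g) (binomialSum m h) _ _)
  where
  interchange : ∀ a b c d → (a - b) + (c - d) ≡ (a + c) - (b + d)
  interchange = solve-∀

δ : ℕ → ℕ → ℤ
δ zero    zero    = + 1
δ zero    (suc _) = + 0
δ (suc _) zero    = + 0
δ (suc m) (suc j) = δ m j

-- y^m = (1 + (y − 1))^m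
binomialSum-coeff-[y-1]^ : ∀ m j → binomialSum m (λ k → coeff (y-1 ^y k) j) ≡ δ m j
binomialSum-coeff-[y-1]^ zero    zero    = refl
binomialSum-coeff-[y-1]^ zero    (suc j) = refl
binomialSum-coeff-[y-1]^ (suc m) zero    = begin
  binomialSum m c₀ + binomialSum m (λ k → coeff (y-1 ^y suc k) 0)
    ≡⟨ cong (_+_ (binomialSum m c₀)) (binomialSum-cong m coeff-[y-1]^suc-zero) ⟩
  binomialSum m c₀ + binomialSum m (λ k → - c₀ k)
    ≡⟨ cong (_+_ (binomialSum m c₀)) (binomialSum-neg m c₀) ⟩
  binomialSum m c₀ - binomialSum m c₀
    ≡⟨ ℤₚ.+-inverseʳ (binomialSum m c₀) ⟩
  + 0
    ∎
  where
  open ≡-Reasoning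
  c₀ : ℕ → ℤ
  c₀ k = coeff (y-1 ^y k) 0
binomialSum-coeff-[y-1]^ (suc m) (suc j) = begin
  binomialSum m (c (suc j)) + binomialSum m (λ k → coeff (y-1 ^y suc k) (suc j))
    ≡⟨ cong (_+_ (binomialSum m (c (suc j)))) (binomialSum-cong m (λ k → coeff-[y-1]^suc-suc k j)) ⟩
  binomialSum m (c (suc j)) + binomialSum m (λ k → c j k - c (suc j) k)
    ≡⟨ cong (_+_ (binomialSum m (c (suc j)))) (binomialSum-- m (c j) (c (suc j))) ⟩
  binomialSum m (c (suc j)) + (binomialSum m (c j) - binomialSum m (c (suc j)))
    ≡⟨ cong₂ (λ u v → u + (v - u)) (binomialSum-coeff-[y-1]^ m (suc j)) (binomialSum-coeff-[y-1]^ m j) ⟩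
  δ m (suc j) + (δ m j - δ m (suc j))
    ≡⟨ cancel (δ m (suc j)) (δ m j) ⟩
  δ m j
    ∎
  where
  open ≡-Reasoning
  c : ℕ → ℕ → ℤ
  c j k = coeff (y-1 ^y k) j
  cancel : ∀ a b → a + (b - a) ≡ b
  cancel = solve-∀

shiftedBinom : ℕ → ℕ → ℕ → ℤ
shiftedBinom zero    j       s = + 0
shiftedBinom (suc m) zero    s = + (m C s)
shiftedBinom (suc m) (suc j) s = shiftedBinom m j s

binomℤ-shiftedBinom : ∀ m j s → binomℤ (+ m - + j - + 1) s ≡ shiftedBinom m j s
binomℤ-shiftedBinom m j s = trans (cong (λ z → binomℤ z s) (m-j-1≡m⊖[1+j] m j)) (binomℤ-⊖ m j)
  where
  m-j-1≡m⊖[1+j] : ∀ m j → + m - + j - + 1 ≡ m ⊖ suc j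
  m-j-1≡m⊖[1+j] m j = trans (reassoc (+ m) (+ j)) (ℤₚ.m-n≡m⊖n m (suc j))
    where
    reassoc : ∀ a b → a - b - + 1 ≡ a - (+ 1 + b)
    reassoc = solve-∀
  binomℤ-⊖ : ∀ m j → binomℤ (m ⊖ suc j) s ≡ shiftedBinom m j s
  binomℤ-⊖ zero    j       = refl
  binomℤ-⊖ (suc m) zero    = refl
  binomℤ-⊖ (suc m) (suc j) = trans (cong (λ z → binomℤ z s) (ℤₚ.[1+m]⊖[1+n]≡m⊖n m (suc j))) (binomℤ-⊖ m j)

shiftedBinom-pascal : ∀ m j s → shiftedBinom (suc m) j (suc s) ≡ shiftedBinom m j (suc s) + shiftedBinom m j s
shiftedBinom-pascal zero    zero    s = refl
shiftedBinom-pascal (suc m) zero    s =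
  sym (trans (ℤₚ.pos-+ (m C suc s) (m C s))
             (cong +_ (trans (ℕₚ.+-comm (m C suc s) (m C s)) (nCk+nC[k+1]≡[n+1]C[k+1] m s))))
shiftedBinom-pascal zero    (suc j) s = refl
shiftedBinom-pascal (suc m) (suc j) s = shiftedBinom-pascal m j s

shiftedBinom-pascal₀ : ∀ m j → shiftedBinom (suc m) j 0 ≡ shiftedBinom m j 0 + δ m j
shiftedBinom-pascal₀ zero    zero    = refl
shiftedBinom-pascal₀ (suc m) zero    = refl
shiftedBinom-pascal₀ zero    (suc j) = refl
shiftedBinom-pascal₀ (suc m) (suc j) = shiftedBinom-pascal₀ m j

-- The contribution to [y^j] T_M(1, y) of a spanning set of size a in a matroid of rank r.
spanCoeff : ℕ → ℕ → ℕ → ℤ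
spanCoeff zero    j a       = coeff (y-1 ^y a) j
spanCoeff (suc r) j zero    = + 0
spanCoeff (suc r) j (suc a) = spanCoeff r j a

spanCoeff-< : ∀ r j {a} → a < r ℕ.+ j → spanCoeff r j a ≡ + 0
spanCoeff-< zero    j {a}     a<j       = coeff-[y-1]^-> a<j
spanCoeff-< (suc r) j {zero}  _         = refl
spanCoeff-< (suc r) j {suc a} (s≤s a<r+j) = spanCoeff-< r j a<r+j

spanCoeff-≥ : ∀ r j {a} → r ≤ a → spanCoeff r j a ≡ coeff (y-1 ^y (a ∸ r)) j
spanCoeff-≥ zero    j _         = refl
spanCoeff-≥ (suc r) j (s≤s r≤a) = spanCoeff-≥ r j r≤a

binomialSum-spanCoeff : ∀ {r} → 0 < r → ∀ m j → binomialSum m (spanCoeff r j) ≡ shiftedBinom m j (r ∸ 1)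
binomialSum-spanCoeff {suc r}       _ zero    j = refl
binomialSum-spanCoeff {suc zero}    _ (suc m) j =
  trans (cong₂ _+_ (binomialSum-spanCoeff {1} z<s m j) (binomialSum-coeff-[y-1]^ m j))
        (sym (shiftedBinom-pascal₀ m j))
binomialSum-spanCoeff {suc (suc r)} _ (suc m) j =
  trans (cong₂ _+_ (binomialSum-spanCoeff {suc (suc r)} z<s m j) (binomialSum-spanCoeff {suc r} z<s m j))
        (sym (shiftedBinom-pascal m j r))

<⇒≤∸1 : ∀ {m n} → m < n → m ≤ n ∸ 1
<⇒≤∸1 {m} {n} m<n = subst (m ≤_) (ℕₚ.pred[m∸n]≡m∸[1+n] n 0) (ℕₚ.<⇒≤pred m<n)

∸1<⇒≤ : ∀ {m n} → m ∸ 1 < n → m ≤ n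
∸1<⇒≤ {m} m∸1<n = ℕₚ.≤-trans (ℕₚ.m≤n+m∸n m 1) m∸1<n

+m-+n<+o⇒m<n+o : ∀ m n o → + m - + n ℤ.< + o → m < n ℕ.+ o
+m-+n<+o⇒m<n+o m n o m-n<o =
  ℤₚ.drop‿+<+ (subst (ℤ._< + (n ℕ.+ o)) (cancel (+ n) (+ m)) (ℤₚ.+-monoʳ-< (+ n) m-n<o))
  where
  cancel : ∀ a b → a + (b - a) ≡ b
  cancel = solve-∀

≤-foldr-⊔ : ∀ {m ms} → m ∈ˡ ms → m ≤ foldr _⊔_ 0 ms
≤-foldr-⊔ {m} {_ ∷ ms} (here refl) = ℕₚ.m≤m⊔n m _
≤-foldr-⊔ {m} {k ∷ ms} (there m∈ms) = ℕₚ.≤-trans (≤-foldr-⊔ m∈ms) (ℕₚ.m≤n⊔m k _)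

T⇔T⇒≡ : ∀ {a b} → (T a → T b) → (T b → T a) → a ≡ b
T⇔T⇒≡ {false} {false} _   _   = refl
T⇔T⇒≡ {false} {true}  _   b⇒a = ⊥-elim (b⇒a _)
T⇔T⇒≡ {true}  {false} a⇒b _   = ⊥-elim (a⇒b _)
T⇔T⇒≡ {true}  {true}  _   _   = refl

sumMap-allSubsets-suc : ∀ n (h : Subset (suc n) → ℤ) →
  sumMap (allSubsets (suc n)) h ≡
  sumMap (allSubsets n) (h ∘ (false ∷_)) + sumMap (allSubsets n) (h ∘ (true ∷_))
sumMap-allSubsets-suc n h =
  trans (sumMap-++ (map (false ∷_) (allSubsets n)) _ h)
        (cong₂ _+_ (sumMap-map (false ∷_) (allSubsets n) h) (sumMap-map (true ∷_) (allSubsets n) h))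

sumMap-allSubsets-∁ : ∀ n (h : Subset n → ℤ) → sumMap (allSubsets n) (h ∘ ∁) ≡ sumMap (allSubsets n) h
sumMap-allSubsets-∁ zero    h = refl
sumMap-allSubsets-∁ (suc n) h = begin
  sumMap (allSubsets (suc n)) (h ∘ ∁)
    ≡⟨ sumMap-allSubsets-suc n (h ∘ ∁) ⟩
  sumMap (allSubsets n) (h ∘ (true ∷_) ∘ ∁) + sumMap (allSubsets n) (h ∘ (false ∷_) ∘ ∁)
    ≡⟨ cong₂ _+_ (sumMap-allSubsets-∁ n (h ∘ (true ∷_))) (sumMap-allSubsets-∁ n (h ∘ (false ∷_))) ⟩
  sumMap (allSubsets n) (h ∘ (true ∷_)) + sumMap (allSubsets n) (h ∘ (false ∷_))
    ≡⟨ ℤₚ.+-comm (sumMap (allSubsets n) (h ∘ (true ∷_))) _ ⟩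
  sumMap (allSubsets n) (h ∘ (false ∷_)) + sumMap (allSubsets n) (h ∘ (true ∷_))
    ≡⟨ sumMap-allSubsets-suc n h ⟨
  sumMap (allSubsets (suc n)) h
    ∎
  where open ≡-Reasoning

sumMap-allSubsets-∣∣ : ∀ n (g : ℕ → ℤ) → sumMap (allSubsets n) (g ∘ ∣_∣) ≡ binomialSum n g
sumMap-allSubsets-∣∣ zero    g = ℤₚ.+-identityʳ (g 0)
sumMap-allSubsets-∣∣ (suc n) g =
  trans (sumMap-allSubsets-suc n (g ∘ ∣_∣))
        (cong₂ _+_ (sumMap-allSubsets-∣∣ n g) (sumMap-allSubsets-∣∣ n (g ∘ suc)))

sumMap-allSubsets-⊆-∣∣ : ∀ {n} (S : Subset n) (g : ℕ → ℤ) →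
  sumMap (allSubsets n) (λ A → if does (A SP.⊆? S) then g ∣ A ∣ else + 0) ≡ binomialSum ∣ S ∣ g
sumMap-allSubsets-⊆-∣∣ []           g = ℤₚ.+-identityʳ (g 0)
sumMap-allSubsets-⊆-∣∣ {suc n} (true  ∷ S) g =
  trans (sumMap-allSubsets-suc n _)
        (cong₂ _+_ (sumMap-allSubsets-⊆-∣∣ S g) (sumMap-allSubsets-⊆-∣∣ S (g ∘ suc)))
sumMap-allSubsets-⊆-∣∣ {suc n} (false ∷ S) g =
  trans (sumMap-allSubsets-suc n _)
        (trans (cong₂ _+_ (sumMap-allSubsets-⊆-∣∣ S g) (sumMap-zero (allSubsets n) (λ _ → refl)))
               (ℤₚ.+-identityʳ _))

∈-allSubsets : ∀ {n} (A : Subset n) → A ∈ˡ allSubsets n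
∈-allSubsets []                    = here refl
∈-allSubsets {suc n} (false ∷ A) = ∈-++⁺ˡ (∈-map⁺ (false ∷_) (∈-allSubsets A))
∈-allSubsets {suc n} (true  ∷ A) = ∈-++⁺ʳ (map (false ∷_) (allSubsets n)) (∈-map⁺ (true ∷_) (∈-allSubsets A))

allSubsets-unique : ∀ n → Unique (allSubsets n)
allSubsets-unique zero    = [] ∷ []
allSubsets-unique (suc n) =
  Unique.++⁺ (Unique.map⁺ ∷-injectiveʳ (allSubsets-unique n)) (Unique.map⁺ ∷-injectiveʳ (allSubsets-unique n))
             disjoint
  where
  ∷-injectiveʳ : ∀ {b} {A B : Subset n} → b ∷ A ≡ b ∷ B → A ≡ B
  ∷-injectiveʳ refl = refl
  disjoint : ∀ {A} → ¬ (A ∈ˡ map (false ∷_) (allSubsets n) × A ∈ˡ map (true ∷_) (allSubsets n))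
  disjoint (A∈₀ , A∈₁) with ∈-map⁻ (false ∷_) A∈₀ | ∈-map⁻ (true ∷_) A∈₁
  ... | _ , _ , refl | _ , _ , ()

∪⁅⁆⊆ : ∀ {n} {A B : Subset n} {e} → A ⊆ B → e ∈ B → A ∪ ⁅ e ⁆ ⊆ B
∪⁅⁆⊆ {A = A} {e = e} A⊆B e∈B x∈A∪e with SP.x∈p∪q⁻ A ⁅ e ⁆ x∈A∪e
... | inj₁ x∈A   = A⊆B x∈A
... | inj₂ x∈⁅e⁆ rewrite SP.x∈⁅y⁆⇒x≡y e x∈⁅e⁆ = e∈B

∁-involutive : ∀ {n} (p : Subset n) → ∁ (∁ p) ≡ p
∁-involutive {n} = BooleanAlgebra.¬-involutive (SP.∪-∩-booleanAlgebra n)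

∣∁p∣<ᵇn∸k≡k<ᵇ∣p∣ : ∀ {n} (p : Subset n) k → (∣ ∁ p ∣ <ᵇ n ∸ k) ≡ (k <ᵇ ∣ p ∣)
∣∁p∣<ᵇn∸k≡k<ᵇ∣p∣ {n} p k = trans (cong (_<ᵇ n ∸ k) (SP.∣∁p∣≡n∸∣p∣ p)) (T⇔T⇒≡
  (λ ∣∁p∣<n∸k → ℕₚ.<⇒<ᵇ (ℕₚ.∸-cancelʳ-< {∣ p ∣} {k} {n} (ℕₚ.<ᵇ⇒< (n ∸ ∣ p ∣) (n ∸ k) ∣∁p∣<n∸k)))
  (λ k<∣p∣ → ℕₚ.<⇒<ᵇ (ℕₚ.∸-monoʳ-< (ℕₚ.<ᵇ⇒< _ _ k<∣p∣) (SP.∣p∣≤n p))))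

+n-+∣∁p∣≡+∣p∣ : ∀ {n} (p : Subset n) → + n - + ∣ ∁ p ∣ ≡ + ∣ p ∣
+n-+∣∁p∣≡+∣p∣ {n} p = begin
  + n - + ∣ ∁ p ∣      ≡⟨ cong (λ m → + n - + m) (SP.∣∁p∣≡n∸∣p∣ p) ⟩
  + n - + (n ∸ ∣ p ∣)  ≡⟨ ℤₚ.m-n≡m⊖n n (n ∸ ∣ p ∣) ⟩
  n ℤ.⊖ (n ∸ ∣ p ∣)    ≡⟨ ℤₚ.⊖-≥ (ℕₚ.m∸n≤m n ∣ p ∣) ⟩
  + (n ∸ (n ∸ ∣ p ∣))  ≡⟨ cong +_ (ℕₚ.m∸[m∸n]≡n (SP.∣p∣≤n p)) ⟩
  + ∣ p ∣              ∎
  where open ≡-Reasoning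

-- Flats and hyperplanes

module _ {n : ℕ} (M : Matroid n) where
  open Matroid M

  IsHyperplane : Subset n → Set
  IsHyperplane H = IsFlat M H × rk H ≡ rank M ∸ 1

  largeHyperplanes : List (Subset n)
  largeHyperplanes = filterᵇ (λ H → f M 2 <ᵇ ∣ H ∣) (hyperplanes M)

  rk≤rank : ∀ A → rk A ≤ rank M
  rk≤rank A = rk-mono SP.⊆⊤

  rk-∪⁅⁆≤suc : ∀ A e → rk (A ∪ ⁅ e ⁆) ≤ suc (rk A)
  rk-∪⁅⁆≤suc A e = begin
    rk (A ∪ ⁅ e ⁆)                    ≤⟨ ℕₚ.m≤m+n _ _ ⟩
    rk (A ∪ ⁅ e ⁆) ℕ.+ rk (A ∩ ⁅ e ⁆) ≤⟨ rk-submod A ⁅ e ⁆ ⟩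
    rk A ℕ.+ rk ⁅ e ⁆                 ≤⟨ ℕₚ.+-monoʳ-≤ (rk A) (rk-bound ⁅ e ⁆) ⟩
    rk A ℕ.+ ∣ ⁅ e ⁆ ∣                ≡⟨ cong (rk A ℕ.+_) (SP.∣⁅x⁆∣≡1 e) ⟩
    rk A ℕ.+ 1                        ≡⟨ ℕₚ.+-comm (rk A) 1 ⟩
    suc (rk A)                        ∎
    where open ℕₚ.≤-Reasoning

  ∈-cl⁻ : ∀ {A e} → e ∈ cl M A → rk (A ∪ ⁅ e ⁆) ≡ rk A
  ∈-cl⁻ {A} {e} e∈clA =
    toWitness (Equivalence.from T-≡ (trans (sym (lookup∘tabulate _ e)) ([]=⇒lookup e∈clA)))

  ∈-cl⁺ : ∀ {A e} → rk (A ∪ ⁅ e ⁆) ≡ rk A → e ∈ cl M A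
  ∈-cl⁺ {A} {e} eq =
    lookup⇒[]= e (cl M A) (trans (lookup∘tabulate _ e) (Equivalence.to T-≡ (fromWitness eq)))

  ⊆-cl : ∀ A → A ⊆ cl M A
  ⊆-cl A e∈A = ∈-cl⁺ (ℕₚ.≤-antisym (rk-mono (∪⁅⁆⊆ id e∈A)) (rk-mono (SP.p⊆p∪q _)))

  flat-rk-∪⁅⁆ : ∀ {F e} → IsFlat M F → e ∉ F → rk F < rk (F ∪ ⁅ e ⁆)
  flat-rk-∪⁅⁆ {F} {e} flat e∉F =
    ℕₚ.≤∧≢⇒< (rk-mono (SP.p⊆p∪q _)) (λ eq → e∉F (subst (e ∈_) flat (∈-cl⁺ (sym eq))))

  flat-absorb : ∀ {F G} → IsFlat M F → F ⊆ G → rk G ≤ rk F → G ⊆ F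
  flat-absorb {F} flat F⊆G rkG≤rkF {e} e∈G = subst (e ∈_) flat (∈-cl⁺
    (ℕₚ.≤-antisym (ℕₚ.≤-trans (rk-mono (∪⁅⁆⊆ F⊆G e∈G)) rkG≤rkF) (rk-mono (SP.p⊆p∪q _))))

  module Greedy (t : ℕ) where

    greedy : Subset n → List (Fin n) → Subset n
    greedy G []       = G
    greedy G (e ∷ es) with rk (G ∪ ⁅ e ⁆) ℕ.≤? t
    ... | yes _ = greedy (G ∪ ⁅ e ⁆) es
    ... | no  _ = greedy G es

    greedy-⊇ : ∀ G es → G ⊆ greedy G es
    greedy-⊇ G []       = id
    greedy-⊇ G (e ∷ es) with rk (G ∪ ⁅ e ⁆) ℕ.≤? t
    ... | yes _ = greedy-⊇ (G ∪ ⁅ e ⁆) es ∘ SP.p⊆p∪q _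
    ... | no  _ = greedy-⊇ G es

    greedy-rk≤ : ∀ G es → rk G ≤ t → rk (greedy G es) ≤ t
    greedy-rk≤ G []       rkG≤t = rkG≤t
    greedy-rk≤ G (e ∷ es) rkG≤t with rk (G ∪ ⁅ e ⁆) ℕ.≤? t
    ... | yes rk≤t = greedy-rk≤ (G ∪ ⁅ e ⁆) es rk≤t
    ... | no  _    = greedy-rk≤ G es rkG≤t

    greedy-maximal : ∀ G es {e} → e ∈ˡ es → e ∈ greedy G es ⊎ t < rk (greedy G es ∪ ⁅ e ⁆)
    greedy-maximal G (e ∷ es) (here refl) with rk (G ∪ ⁅ e ⁆) ℕ.≤? t
    ... | yes _  = inj₁ (greedy-⊇ (G ∪ ⁅ e ⁆) es (SP.q⊆p∪q G ⁅ e ⁆ (SP.x∈⁅x⁆ e)))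
    ... | no  ≰t = inj₂ (ℕₚ.<-≤-trans (ℕₚ.≰⇒> ≰t) (rk-mono
                     (∪⁅⁆⊆ (SP.p⊆p∪q _ ∘ greedy-⊇ G es) (SP.q⊆p∪q _ ⁅ e ⁆ (SP.x∈⁅x⁆ e)))))
    greedy-maximal G (e ∷ es) (there e′∈es) with rk (G ∪ ⁅ e ⁆) ℕ.≤? t
    ... | yes _ = greedy-maximal (G ∪ ⁅ e ⁆) es e′∈es
    ... | no  _ = greedy-maximal G es e′∈es

  maximal-rk≤⇒flat : ∀ {G t} → rk G ≤ t → (∀ e → e ∈ G ⊎ t < rk (G ∪ ⁅ e ⁆)) → IsFlat M G
  maximal-rk≤⇒flat {G} {t} rkG≤t maximal = SP.⊆-antisym cl⊆G (⊆-cl G)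
    where
    cl⊆G : cl M G ⊆ G
    cl⊆G {e} e∈cl with maximal e
    ... | inj₁ e∈G  = e∈G
    ... | inj₂ t<rk = ⊥-elim (ℕₚ.<⇒≱ t<rk (subst (_≤ t) (sym (∈-cl⁻ e∈cl)) rkG≤t))

  maximal-rk≤⇒rk≡ : ∀ {G t} → t < rank M → rk G ≤ t → (∀ e → e ∈ G ⊎ t < rk (G ∪ ⁅ e ⁆)) → rk G ≡ t
  maximal-rk≤⇒rk≡ {G} {t} t<r rkG≤t maximal with rk G ℕ.<? t
  ... | no  rkG≮t = ℕₚ.≤-antisym rkG≤t (ℕₚ.≮⇒≥ rkG≮t)
  ... | yes rkG<t = ⊥-elim (ℕₚ.<⇒≱ t<r (subst (λ X → rk X ≤ t) (SP.⊆-antisym SP.⊆⊤ ⊤⊆G) rkG≤t))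
    where
    ⊤⊆G : ⊤ ⊆ G
    ⊤⊆G {e} _ with maximal e
    ... | inj₁ e∈G  = e∈G
    ... | inj₂ t<rk = ⊥-elim (ℕₚ.<⇒≱ t<rk (ℕₚ.≤-trans (rk-∪⁅⁆≤suc G e) rkG<t))

  extendToFlat : ∀ {t} B → rk B ≤ t → t < rank M → ∃ λ G → B ⊆ G × IsFlat M G × rk G ≡ t
  extendToFlat {t} B rkB≤t t<r =
    G , greedy-⊇ B (allFin n) , maximal-rk≤⇒flat rkG≤t maximal , maximal-rk≤⇒rk≡ t<r rkG≤t maximal
    where
    open Greedy t
    G : Subset n
    G = greedy B (allFin n)
    rkG≤t : rk G ≤ t
    rkG≤t = greedy-rk≤ B (allFin n) rkB≤t
    maximal : ∀ e → e ∈ G ⊎ t < rk (G ∪ ⁅ e ⁆)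
    maximal e = greedy-maximal B (allFin n) (∈-allFin e)

  isFlatOfRankᵇ : ℕ → Subset n → Bool
  isFlatOfRankᵇ k F = isFlatᵇ M F ∧ (rk F ≡ᵇ k)

  T-isFlatOfRankᵇ⁻ : ∀ {k F} → T (isFlatOfRankᵇ k F) → IsFlat M F × rk F ≡ k
  T-isFlatOfRankᵇ⁻ {k} {F} t with Equivalence.to T-∧ t
  ... | flat , rk≡k = toWitness {a? = cl M F ≟S F} flat , ℕₚ.≡ᵇ⇒≡ (rk F) k rk≡k

  T-isFlatOfRankᵇ⁺ : ∀ {k F} → IsFlat M F × rk F ≡ k → T (isFlatOfRankᵇ k F)
  T-isFlatOfRankᵇ⁺ {k} {F} (flat , rk≡k) = Equivalence.from T-∧ (fromWitness flat , ℕₚ.≡⇒≡ᵇ (rk F) k rk≡k)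

  ∈-flatsOfRank⁻ : ∀ {F k} → F ∈ˡ flatsOfRank M k → IsFlat M F × rk F ≡ k
  ∈-flatsOfRank⁻ {k = k} F∈ = T-isFlatOfRankᵇ⁻ (proj₂ (∈-filterᵇ⁻ (isFlatOfRankᵇ k) {xs = allSubsets n} F∈))

  ∈-flatsOfRank⁺ : ∀ {F k} → IsFlat M F → rk F ≡ k → F ∈ˡ flatsOfRank M k
  ∈-flatsOfRank⁺ {F} {k} flat rk≡k =
    ∈-filterᵇ⁺ (isFlatOfRankᵇ k) (∈-allSubsets F) (T-isFlatOfRankᵇ⁺ (flat , rk≡k))

  ∣∣≤f : ∀ {k A} → rank M ∸ k < rank M → rk A ≤ rank M ∸ k → ∣ A ∣ ≤ f M k
  ∣∣≤f {k} {A} r∸k<r rkA≤r∸k with extendToFlat A rkA≤r∸k r∸k<r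
  ... | F , A⊆F , flat , rk≡ =
    ℕₚ.≤-trans (SP.p⊆q⇒∣p∣≤∣q∣ A⊆F) (≤-foldr-⊔ (∈-map⁺ ∣_∣ (∈-flatsOfRank⁺ flat rk≡)))

  ⊆-hyperplane-rk< : ∀ {A H} → 1 ≤ rank M → IsHyperplane H → A ⊆ H → rk A < rank M
  ⊆-hyperplane-rk< r≥1 (_ , rkH≡r∸1) A⊆H =
    ℕₚ.≤-<-trans (ℕₚ.≤-trans (rk-mono A⊆H) (ℕₚ.≤-reflexive rkH≡r∸1)) (ℕₚ.∸-monoʳ-< (s≤s z≤n) r≥1)

  distinct-hyperplanes-span : ∀ {H₁ H₂} → IsHyperplane H₁ → IsHyperplane H₂ → H₁ ≢ H₂ →
                              rank M ≤ rk (H₁ ∪ H₂)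
  distinct-hyperplanes-span {H₁} {H₂} (flat₁ , rk₁) (flat₂ , rk₂) H₁≢H₂ with rank M ℕ.≤? rk (H₁ ∪ H₂)
  ... | yes r≤rk = r≤rk
  ... | no  r≰rk = ⊥-elim (H₁≢H₂ (SP.⊆-antisym (∪⊆H₂ ∘ SP.p⊆p∪q H₂) (∪⊆H₁ ∘ SP.q⊆p∪q H₁ H₂)))
    where
    rk∪≤r∸1 : rk (H₁ ∪ H₂) ≤ rank M ∸ 1
    rk∪≤r∸1 = <⇒≤∸1 (ℕₚ.≰⇒> r≰rk)
    ∪⊆H₁ : H₁ ∪ H₂ ⊆ H₁
    ∪⊆H₁ = flat-absorb flat₁ (SP.p⊆p∪q H₂) (subst (rk (H₁ ∪ H₂) ≤_) (sym rk₁) rk∪≤r∸1)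
    ∪⊆H₂ : H₁ ∪ H₂ ⊆ H₂
    ∪⊆H₂ = flat-absorb flat₂ (SP.q⊆p∪q H₁ H₂) (subst (rk (H₁ ∪ H₂) ≤_) (sym rk₂) rk∪≤r∸1)

  rk-∩-distinct-hyperplanes : ∀ {H₁ H₂} → IsHyperplane H₁ → IsHyperplane H₂ → H₁ ≢ H₂ →
                              rk (H₁ ∩ H₂) ≤ rank M ∸ 2
  rk-∩-distinct-hyperplanes {H₁} {H₂} hyp₁ hyp₂ H₁≢H₂ =
    ≤∸2 (rank M) (distinct-hyperplanes-span hyp₁ hyp₂ H₁≢H₂)
        (subst₂ (λ a b → rk (H₁ ∪ H₂) ℕ.+ rk (H₁ ∩ H₂) ≤ a ℕ.+ b) (proj₂ hyp₁) (proj₂ hyp₂) (rk-submod H₁ H₂))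
    where
    ≤∸2 : ∀ r {x y} → r ≤ y → y ℕ.+ x ≤ (r ∸ 1) ℕ.+ (r ∸ 1) → x ≤ r ∸ 2
    ≤∸2 zero          {y = y} _         y+x≤0 = ℕₚ.m+n≤o⇒n≤o y y+x≤0
    ≤∸2 (suc zero)    (s≤s z≤n) ()
    ≤∸2 (suc (suc r)) {x} {y} r+2≤y y+x≤2r+2 = ℕₚ.+-cancelˡ-≤ r x r (ℕₚ.≤-pred (ℕₚ.≤-pred (begin
      suc (suc r) ℕ.+ x ≤⟨ ℕₚ.+-monoˡ-≤ x r+2≤y ⟩
      y ℕ.+ x           ≤⟨ y+x≤2r+2 ⟩
      suc r ℕ.+ suc r   ≡⟨ cong suc (ℕₚ.+-suc r r) ⟩
      suc (suc (r ℕ.+ r)) ∎)))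
      where open ℕₚ.≤-Reasoning

  hyperplane-⊇-unique : ∀ {A H₁ H₂} → 2 ≤ rank M → f M 2 < ∣ A ∣ → IsHyperplane H₁ → IsHyperplane H₂ →
                        A ⊆ H₁ → A ⊆ H₂ → H₁ ≡ H₂
  hyperplane-⊇-unique {A} {H₁} {H₂} r≥2 f₂<∣A∣ hyp₁ hyp₂ A⊆H₁ A⊆H₂ with H₁ ≟S H₂
  ... | yes H₁≡H₂ = H₁≡H₂
  ... | no  H₁≢H₂ = ⊥-elim (ℕₚ.<⇒≱ f₂<∣A∣ (ℕₚ.≤-trans
          (SP.p⊆q⇒∣p∣≤∣q∣ (λ x∈A → SP.x∈p∩q⁺ (A⊆H₁ x∈A , A⊆H₂ x∈A)))
          (∣∣≤f {2} (ℕₚ.∸-monoʳ-< (s≤s z≤n) r≥2) (rk-∩-distinct-hyperplanes hyp₁ hyp₂ H₁≢H₂))))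

  ∈-largeHyperplanes⁻ : ∀ {H} → H ∈ˡ largeHyperplanes → IsHyperplane H
  ∈-largeHyperplanes⁻ H∈ = ∈-flatsOfRank⁻ (proj₁ (∈-filterᵇ⁻ _ H∈))

  largeHyperplanes-unique : Unique largeHyperplanes
  largeHyperplanes-unique = Unique.filter⁺ (T? ∘ _) (Unique.filter⁺ (T? ∘ _) (allSubsets-unique n))

  large-nonspanning-⊆-largeHyperplane : ∀ {A} → rk A < rank M → f M 2 < ∣ A ∣ →
                                        ∃ λ H → H ∈ˡ largeHyperplanes × A ⊆ H
  large-nonspanning-⊆-largeHyperplane {A} rkA<r f₂<∣A∣
    with extendToFlat A (<⇒≤∸1 rkA<r) (ℕₚ.∸-monoʳ-< (s≤s z≤n) (ℕₚ.≤-trans (s≤s z≤n) rkA<r))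
  ... | H , A⊆H , flat , rk≡ =
    H , ∈-filterᵇ⁺ _ (∈-flatsOfRank⁺ flat rk≡) (ℕₚ.<⇒<ᵇ (ℕₚ.<-≤-trans f₂<∣A∣ (SP.p⊆q⇒∣p∣≤∣q∣ A⊆H))) , A⊆H

  -- Cocircuits

  rank≤∣∣+rk∁ : ∀ B → rank M ≤ ∣ B ∣ ℕ.+ rk (∁ B)
  rank≤∣∣+rk∁ B = begin
    rank M                        ≡⟨ cong rk (SP.p∪∁p≡⊤ B) ⟨
    rk (B ∪ ∁ B)                  ≤⟨ ℕₚ.m≤m+n _ _ ⟩
    rk (B ∪ ∁ B) ℕ.+ rk (B ∩ ∁ B) ≤⟨ rk-submod B (∁ B) ⟩
    rk B ℕ.+ rk (∁ B)             ≤⟨ ℕₚ.+-monoˡ-≤ (rk (∁ B)) (rk-bound B) ⟩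
    ∣ B ∣ ℕ.+ rk (∁ B)            ∎
    where open ℕₚ.≤-Reasoning

  rk*≡∣∣⁻ : ∀ B → rk* M B ≡ ∣ B ∣ → rk (∁ B) ≡ rank M
  rk*≡∣∣⁻ B rk*≡ = ℕₚ.+-cancelˡ-≡ ∣ B ∣ _ _ (begin
    ∣ B ∣ ℕ.+ rk (∁ B)  ≡⟨ ℕₚ.m∸n+n≡m (rank≤∣∣+rk∁ B) ⟨
    rk* M B ℕ.+ rank M  ≡⟨ cong (ℕ._+ rank M) rk*≡ ⟩
    ∣ B ∣ ℕ.+ rank M    ∎)
    where open ≡-Reasoning

  rk*≡∣∣⁺ : ∀ B → rk (∁ B) ≡ rank M → rk* M B ≡ ∣ B ∣
  rk*≡∣∣⁺ B rk∁B≡r = trans (cong (λ x → (∣ B ∣ ℕ.+ x) ∸ rank M) rk∁B≡r) (ℕₚ.m+n∸n≡m ∣ B ∣ (rank M))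

  rk*<∣∣⁻ : ∀ K → rk* M K < ∣ K ∣ → rk (∁ K) < rank M
  rk*<∣∣⁻ K rk*<∣K∣ = ℕₚ.≤∧≢⇒< (rk≤rank (∁ K)) (ℕₚ.<⇒≢ rk*<∣K∣ ∘ rk*≡∣∣⁺ K)

  rk*<∣∣⁺ : ∀ K → rk (∁ K) < rank M → rk* M K < ∣ K ∣
  rk*<∣∣⁺ K rk∁K<r = ℕₚ.+-cancelʳ-< (rank M) _ _ (begin-strict
    rk* M K ℕ.+ rank M  ≡⟨ ℕₚ.m∸n+n≡m (rank≤∣∣+rk∁ K) ⟩
    ∣ K ∣ ℕ.+ rk (∁ K)  <⟨ ℕₚ.+-monoʳ-< ∣ K ∣ rk∁K<r ⟩
    ∣ K ∣ ℕ.+ rank M    ∎)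
    where open ℕₚ.≤-Reasoning

  -- The test that isCocircuitᵇ K applies to every B.
  ⊂⇒coindependentᵇ : Subset n → Subset n → Bool
  ⊂⇒coindependentᵇ K B = not ⌊ B SP.⊂? K ⌋ ∨ (rk* M B ≡ᵇ ∣ B ∣)

  T-⊂⇒coindependentᵇ⁻ : ∀ {K B} → T (⊂⇒coindependentᵇ K B) → B ⊂ K → rk (∁ B) ≡ rank M
  T-⊂⇒coindependentᵇ⁻ {K} {B} t B⊂K with B SP.⊂? K
  ... | yes _   = rk*≡∣∣⁻ B (ℕₚ.≡ᵇ⇒≡ _ _ t)
  ... | no  B⊄K = ⊥-elim (B⊄K B⊂K)

  T-⊂⇒coindependentᵇ⁺ : ∀ {K B} → (B ⊂ K → rk (∁ B) ≡ rank M) → T (⊂⇒coindependentᵇ K B)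
  T-⊂⇒coindependentᵇ⁺ {K} {B} indep with B SP.⊂? K
  ... | yes B⊂K = ℕₚ.≡⇒≡ᵇ _ _ (rk*≡∣∣⁺ B (indep B⊂K))
  ... | no  _   = _

  T-isCocircuitᵇ⁻ : ∀ {K} → T (isCocircuitᵇ M K) → rk (∁ K) < rank M × (∀ {B} → B ⊂ K → rk (∁ B) ≡ rank M)
  T-isCocircuitᵇ⁻ {K} t with Equivalence.to T-∧ t
  ... | dependent , minimal = rk*<∣∣⁻ K (ℕₚ.<ᵇ⇒< _ _ dependent) , λ {B} →
    T-⊂⇒coindependentᵇ⁻ (All.lookup (T-foldr-∧⁻ (⊂⇒coindependentᵇ K) _ minimal) (∈-allSubsets B))

  T-isCocircuitᵇ⁺ : ∀ {K} → rk (∁ K) < rank M → (∀ {B} → B ⊂ K → rk (∁ B) ≡ rank M) → T (isCocircuitᵇ M K)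
  T-isCocircuitᵇ⁺ {K} rk∁K<r minimal = Equivalence.from T-∧ (ℕₚ.<⇒<ᵇ (rk*<∣∣⁺ K rk∁K<r) ,
    T-foldr-∧⁺ (⊂⇒coindependentᵇ K) (allSubsets n)
               (All.tabulate (λ _ → T-⊂⇒coindependentᵇ⁺ minimal)))

  IsMaximalNonspanning : Subset n → Set
  IsMaximalNonspanning H = rk H < rank M × (∀ {x} → x ∉ H → rk (H ∪ ⁅ x ⁆) ≡ rank M)

  hyperplane⇒maximalNonspanning : ∀ {H} → 1 ≤ rank M → IsHyperplane H → IsMaximalNonspanning H
  hyperplane⇒maximalNonspanning {H} r≥1 hyp@(flat , rkH≡r∸1) = ⊆-hyperplane-rk< r≥1 hyp id , λ {x} x∉H →
    ℕₚ.≤-antisym (rk≤rank _) (∸1<⇒≤ (subst (_< rk (H ∪ ⁅ x ⁆)) rkH≡r∸1 (flat-rk-∪⁅⁆ flat x∉H)))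

  maximalNonspanning⇒hyperplane : ∀ {H} → IsMaximalNonspanning H → IsHyperplane H
  maximalNonspanning⇒hyperplane {H} (rkH<r , spanning) = SP.⊆-antisym cl⊆H (⊆-cl H) , rkH≡r∸1
    where
    cl⊆H : cl M H ⊆ H
    cl⊆H {x} x∈cl with x SP.∈? H
    ... | yes x∈H = x∈H
    ... | no  x∉H = ⊥-elim (ℕₚ.<⇒≢ rkH<r (trans (sym (∈-cl⁻ x∈cl)) (spanning x∉H)))
    H≢⊤ : ¬ (∀ x → x ∈ H)
    H≢⊤ all∈H = ℕₚ.<-irrefl (cong rk (SP.⊆-antisym SP.⊆⊤ (λ {x} _ → all∈H x))) rkH<r
    rkH≡r∸1 : rk H ≡ rank M ∸ 1
    rkH≡r∸1 with Finₚ.¬∀⟶∃¬ n (_∈ H) (SP._∈? H) H≢⊤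
    ... | x , x∉H = cong (_∸ 1) (ℕₚ.≤-antisym rkH<r (subst (_≤ suc (rk H)) (spanning x∉H) (rk-∪⁅⁆≤suc H x)))

  T-isCocircuitᵇ-∁⁻ : ∀ {H} → T (isCocircuitᵇ M (∁ H)) → IsMaximalNonspanning H
  T-isCocircuitᵇ-∁⁻ {H} t with T-isCocircuitᵇ⁻ t
  ... | rk∁∁H<r , minimal = subst (λ X → rk X < rank M) (∁-involutive H) rk∁∁H<r , spanning
    where
    spanning : ∀ {x} → x ∉ H → rk (H ∪ ⁅ x ⁆) ≡ rank M
    spanning {x} x∉H = subst (λ X → rk X ≡ rank M) (∁-involutive (H ∪ ⁅ x ⁆)) (minimal
      (SP.p⊆q⇒∁p⊇∁q (SP.p⊆p∪q _) , x , SP.x∉p⇒x∈∁p x∉H , SP.x∈p⇒x∉∁p (SP.q⊆p∪q H ⁅ x ⁆ (SP.x∈⁅x⁆ x))))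

  T-isCocircuitᵇ-∁⁺ : ∀ {H} → IsMaximalNonspanning H → T (isCocircuitᵇ M (∁ H))
  T-isCocircuitᵇ-∁⁺ {H} (rkH<r , spanning) =
    T-isCocircuitᵇ⁺ (subst (λ X → rk X < rank M) (sym (∁-involutive H)) rkH<r) minimal
    where
    minimal : ∀ {B} → B ⊂ ∁ H → rk (∁ B) ≡ rank M
    minimal {B} (B⊆∁H , x , x∈∁H , x∉B) = ℕₚ.≤-antisym (rk≤rank (∁ B)) (begin
      rank M         ≡⟨ spanning (SP.x∈∁p⇒x∉p x∈∁H) ⟨
      rk (H ∪ ⁅ x ⁆) ≤⟨ rk-mono (∪⁅⁆⊆ H⊆∁B (SP.x∉p⇒x∈∁p x∉B)) ⟩
      rk (∁ B)       ∎)
      where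
      open ℕₚ.≤-Reasoning
      H⊆∁B : H ⊆ ∁ B
      H⊆∁B y∈H = SP.x∉p⇒x∈∁p (λ y∈B → SP.x∈∁p⇒x∉p (B⊆∁H y∈B) y∈H)

  isCocircuitᵇ-∁≡isHyperplaneᵇ : 1 ≤ rank M → ∀ H → isCocircuitᵇ M (∁ H) ≡ isFlatOfRankᵇ (rank M ∸ 1) H
  isCocircuitᵇ-∁≡isHyperplaneᵇ r≥1 H = T⇔T⇒≡
    (T-isFlatOfRankᵇ⁺ ∘ maximalNonspanning⇒hyperplane ∘ T-isCocircuitᵇ-∁⁻)
    (T-isCocircuitᵇ-∁⁺ ∘ hyperplane⇒maximalNonspanning r≥1 ∘ T-isFlatOfRankᵇ⁻)

  sumMap-filterᵇ-cocircuits : 1 ≤ rank M → ∀ {p q : Subset n → Bool} {g h : Subset n → ℤ} →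
    (∀ H → p (∁ H) ≡ q H) → (∀ H → g (∁ H) ≡ h H) →
    sumMap (filterᵇ p (cocircuits M)) g ≡ sumMap (filterᵇ q (hyperplanes M)) h
  sumMap-filterᵇ-cocircuits r≥1 {p} {q} {g} {h} p∘∁≗q g∘∁≗h = begin
    sumMap (filterᵇ p (cocircuits M)) g
      ≡⟨ sumMap-filterᵇ² (isCocircuitᵇ M) p g ⟩
    sumMap (allSubsets n) (λ C → if isCocircuitᵇ M C then (if p C then g C else + 0) else + 0)
      ≡⟨ sumMap-allSubsets-∁ n _ ⟨
    sumMap (allSubsets n) (λ H → if isCocircuitᵇ M (∁ H) then (if p (∁ H) then g (∁ H) else + 0) else + 0)
      ≡⟨ sumMap-cong (allSubsets n) (λ {H} _ → cong₂ (λ b v → if b then v else + 0)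
           (isCocircuitᵇ-∁≡isHyperplaneᵇ r≥1 H) (cong₂ (λ b v → if b then v else + 0) (p∘∁≗q H) (g∘∁≗h H))) ⟩
    sumMap (allSubsets n) (λ H → if isFlatOfRankᵇ (rank M ∸ 1) H then (if q H then h H else + 0) else + 0)
      ≡⟨ sumMap-filterᵇ² (isFlatOfRankᵇ (rank M ∸ 1)) q h ⟨
    sumMap (filterᵇ q (hyperplanes M)) h
      ∎
    where
    open ≡-Reasoning
    sumMap-filterᵇ² : ∀ c p g → sumMap (filterᵇ p (filterᵇ c (allSubsets n))) g ≡
                      sumMap (allSubsets n) (λ C → if c C then (if p C then g C else + 0) else + 0)
    sumMap-filterᵇ² c p g =
      trans (sumMap-filterᵇ p (filterᵇ c (allSubsets n)) g) (sumMap-filterᵇ c (allSubsets n) _)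

  -- The coefficient of y^j in T_M(1, y)

  tutteTerm : Subset n → ℤ[x,y]
  tutteTerm A = (x-1 ^x (rank M ∸ rk A)) Bi.*P constX (y-1 ^y (∣ A ∣ ∸ rk A))

  coeff-evalX1-tutteTerm-spanning : ∀ {A} j → rk A ≡ rank M →
                                    coeff (evalX1 (tutteTerm A)) j ≡ spanCoeff (rank M) j ∣ A ∣
  coeff-evalX1-tutteTerm-spanning {A} j rkA≡r = begin
    coeff (evalX1 ((x-1 ^x (rank M ∸ rk A)) Bi.*P constX (y-1 ^y (∣ A ∣ ∸ rk A)))) j
      ≡⟨ cong (λ k → coeff (evalX1 ((x-1 ^x k) Bi.*P constX (y-1 ^y (∣ A ∣ ∸ rk A)))) j)
              (trans (cong (rank M ∸_) rkA≡r) (ℕₚ.n∸n≡0 (rank M))) ⟩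
    coeff (evalX1 ((x-1 ^x 0) Bi.*P constX (y-1 ^y (∣ A ∣ ∸ rk A)))) j
      ≡⟨ coeff-evalX1-[x-1]^0*constX (y-1 ^y (∣ A ∣ ∸ rk A)) j ⟩
    coeff (y-1 ^y (∣ A ∣ ∸ rk A)) j
      ≡⟨ cong (λ k → coeff (y-1 ^y (∣ A ∣ ∸ k)) j) rkA≡r ⟩
    coeff (y-1 ^y (∣ A ∣ ∸ rank M)) j
      ≡⟨ spanCoeff-≥ (rank M) j (subst (_≤ ∣ A ∣) rkA≡r (rk-bound A)) ⟨
    spanCoeff (rank M) j ∣ A ∣
      ∎
    where open ≡-Reasoning

  coeff-evalX1-tutteTerm-nonspanning : ∀ {A} j → rk A < rank M → coeff (evalX1 (tutteTerm A)) j ≡ + 0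
  coeff-evalX1-tutteTerm-nonspanning j rkA<r = coeff-evalX1-[x-1]^k*constX _ j (ℕₚ.m<n⇒0<n∸m rkA<r)

  sumMap-smallCocircuits : 1 ≤ rank M → (g : ℤ → ℤ) →
    sumMap (filterᵇ (λ C → ∣ C ∣ <ᵇ n ∸ f M 2) (cocircuits M)) (λ C → g (+ n - + ∣ C ∣)) ≡
    sumMap largeHyperplanes (λ H → g (+ ∣ H ∣))
  sumMap-smallCocircuits r≥1 g = sumMap-filterᵇ-cocircuits r≥1
    (λ H → ∣∁p∣<ᵇn∸k≡k<ᵇ∣p∣ H (f M 2)) (λ H → cong g (+n-+∣∁p∣≡+∣p∣ H))

  module _ (r≥2 : 2 ≤ rank M) {j : ℕ} (f₂<r+j : f M 2 < rank M ℕ.+ j) where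

    weight : Subset n → ℤ
    weight A = spanCoeff (rank M) j ∣ A ∣

    weightIf⊆ : Subset n → Subset n → ℤ
    weightIf⊆ A H = if does (A SP.⊆? H) then weight A else + 0

    overcount : Subset n → ℤ
    overcount A = sumMap largeHyperplanes (weightIf⊆ A)

    overcount-spanning : ∀ {A} → rk A ≡ rank M → overcount A ≡ + 0
    overcount-spanning {A} spanning = sumMap-indicator-none (A SP.⊆?_) largeHyperplanes (weight A) λ H∈ A⊆H →
      ℕₚ.<⇒≢ (⊆-hyperplane-rk< (ℕₚ.<⇒≤ r≥2) (∈-largeHyperplanes⁻ H∈) A⊆H) spanning

    w-small : ∀ {A} → ∣ A ∣ < rank M ℕ.+ j → weight A ≡ + 0
    w-small = spanCoeff-< (rank M) j

    overcount-small : ∀ {A} → ∣ A ∣ < rank M ℕ.+ j → overcount A ≡ + 0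
    overcount-small {A} small = sumMap-zero largeHyperplanes λ {H} _ →
      trans (if-cong-then (does (A SP.⊆? H)) (w-small {A} small)) (if-eta (does (A SP.⊆? H)))

    overcount-large : ∀ {A} → rk A < rank M → rank M ℕ.+ j ≤ ∣ A ∣ → overcount A ≡ weight A
    overcount-large {A} nonspanning large with large-nonspanning-⊆-largeHyperplane nonspanning f₂<∣A∣
      where
      f₂<∣A∣ : f M 2 < ∣ A ∣
      f₂<∣A∣ = ℕₚ.<-≤-trans f₂<r+j large
    ... | H₀ , H₀∈ , A⊆H₀ = sumMap-indicator-unique (A SP.⊆?_) (weight A) largeHyperplanes-unique H₀∈ A⊆H₀
      λ H∈ A⊆H → hyperplane-⊇-unique r≥2 (ℕₚ.<-≤-trans f₂<r+j large)
                   (∈-largeHyperplanes⁻ H∈) (∈-largeHyperplanes⁻ H₀∈) A⊆H A⊆H₀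

    coeff-evalX1-tutteTerm : ∀ A → coeff (evalX1 (tutteTerm A)) j ≡ weight A - overcount A
    coeff-evalX1-tutteTerm A with ℕₚ.m≤n⇒m<n∨m≡n (rk≤rank A)
    ... | inj₂ spanning = begin
      coeff (evalX1 (tutteTerm A)) j  ≡⟨ coeff-evalX1-tutteTerm-spanning j spanning ⟩
      weight A                             ≡⟨ ℤₚ.+-identityʳ (weight A) ⟨
      weight A - + 0                       ≡⟨ cong (_-_ (weight A)) (overcount-spanning spanning) ⟨
      weight A - overcount A               ∎
      where open ≡-Reasoning
    ... | inj₁ nonspanning with ∣ A ∣ ℕ.<? rank M ℕ.+ j
    ...   | yes small = begin
      coeff (evalX1 (tutteTerm A)) j  ≡⟨ coeff-evalX1-tutteTerm-nonspanning j nonspanning ⟩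
      + 0 - + 0                       ≡⟨ cong₂ _-_ (w-small {A} small) (overcount-small {A} small) ⟨
      weight A - overcount A               ∎
      where open ≡-Reasoning
    ...   | no  large = begin
      coeff (evalX1 (tutteTerm A)) j  ≡⟨ coeff-evalX1-tutteTerm-nonspanning j nonspanning ⟩
      + 0                             ≡⟨ ℤₚ.+-inverseʳ (weight A) ⟨
      weight A - weight A             ≡⟨ cong (_-_ (weight A)) (overcount-large nonspanning (ℕₚ.≮⇒≥ large)) ⟨
      weight A - overcount A               ∎
      where open ≡-Reasoning

    sumMap-weight : sumMap (allSubsets n) weight ≡ binomℤ (+ n - + j - + 1) (rank M ∸ 1)
    sumMap-weight = begin
      sumMap (allSubsets n) weight           ≡⟨ sumMap-allSubsets-∣∣ n (spanCoeff (rank M) j) ⟩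
      binomialSum n (spanCoeff (rank M) j)   ≡⟨ binomialSum-spanCoeff (ℕₚ.<⇒≤ r≥2) n j ⟩
      shiftedBinom n j (rank M ∸ 1)          ≡⟨ binomℤ-shiftedBinom n j (rank M ∸ 1) ⟨
      binomℤ (+ n - + j - + 1) (rank M ∸ 1)  ∎
      where open ≡-Reasoning

    sumMap-weightIf⊆ : ∀ S → sumMap (allSubsets n) (λ A → weightIf⊆ A S) ≡
                             binomℤ (+ ∣ S ∣ - + j - + 1) (rank M ∸ 1)
    sumMap-weightIf⊆ S = begin
      sumMap (allSubsets n) (λ A → weightIf⊆ A S)  ≡⟨ sumMap-allSubsets-⊆-∣∣ S (spanCoeff (rank M) j) ⟩
      binomialSum (∣ S ∣) (spanCoeff (rank M) j)      ≡⟨ binomialSum-spanCoeff (ℕₚ.<⇒≤ r≥2) (∣ S ∣) j ⟩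
      shiftedBinom (∣ S ∣) j (rank M ∸ 1)             ≡⟨ binomℤ-shiftedBinom (∣ S ∣) j (rank M ∸ 1) ⟨
      binomℤ (+ ∣ S ∣ - + j - + 1) (rank M ∸ 1)     ∎
      where open ≡-Reasoning

    coeff-evalX1-tutte : coeff (evalX1 (tutte M)) j ≡
                         binomℤ (+ n - + j - + 1) (rank M ∸ 1)
                         - sumMap largeHyperplanes (λ H → binomℤ (+ ∣ H ∣ - + j - + 1) (rank M ∸ 1))
    coeff-evalX1-tutte = begin
      coeff (evalX1 (Bi.sumP (map tutteTerm (allSubsets n)))) j
        ≡⟨ trans (coeff-evalX1-sumP (map tutteTerm (allSubsets n)) j)
                 (sumMap-map tutteTerm (allSubsets n) _) ⟩
      sumMap (allSubsets n) (λ A → coeff (evalX1 (tutteTerm A)) j)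
        ≡⟨ sumMap-cong (allSubsets n) (λ {A} _ → coeff-evalX1-tutteTerm A) ⟩
      sumMap (allSubsets n) (λ A → weight A - overcount A)
        ≡⟨ sumMap-- (allSubsets n) weight overcount ⟩
      sumMap (allSubsets n) weight - sumMap (allSubsets n) overcount
        ≡⟨ cong (_-_ (sumMap (allSubsets n) weight)) (sumMap-comm (allSubsets n) largeHyperplanes weightIf⊆) ⟩
      sumMap (allSubsets n) weight
      - sumMap largeHyperplanes (λ H → sumMap (allSubsets n) (λ A → weightIf⊆ A H))
        ≡⟨ cong₂ _-_ sumMap-weight (sumMap-cong largeHyperplanes (λ {H} _ → sumMap-weightIf⊆ H)) ⟩
      binomℤ (+ n - + j - + 1) (rank M ∸ 1)
      - sumMap largeHyperplanes (λ H → binomℤ (+ ∣ H ∣ - + j - + 1) (rank M ∸ 1))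
        ∎
      where open ≡-Reasoning

theorem3p2 : ∀ {n : ℕ} (M : Matroid n) → 2 ≤ rank M → (j : ℕ) →
    + j > (+ f M 2 - + rank M) →
      (coeff (evalX1 (tutte M)) j
        ≡ binomℤ (+ n - + j - + 1) (rank M ∸ 1)
          - sumℤ (map (λ H → binomℤ (+ ∣ H ∣ - + j - + 1) (rank M ∸ 1))
                      (filterᵇ (λ H → f M 2 <ᵇ ∣ H ∣) (hyperplanes M))))
      × (coeff (evalX1 (tutte M)) j
        ≡ binomℤ (+ n - + j - + 1) (rank M ∸ 1)
          - sumℤ (map (λ C → binomℤ (+ n - + ∣ C ∣ - + j - + 1) (rank M ∸ 1))
                      (filterᵇ (λ C → ∣ C ∣ <ᵇ n ∸ f M 2) (cocircuits M))))
theorem3p2 {n} M r≥2 j j>f₂-r =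
  coeff-evalX1-tutte M r≥2 f₂<r+j ,
  trans (coeff-evalX1-tutte M r≥2 f₂<r+j)
        (cong (_-_ (binomℤ (+ n - + j - + 1) (rank M ∸ 1)))
              (sym (sumMap-smallCocircuits M (ℕₚ.<⇒≤ r≥2) (λ m → binomℤ (m - + j - + 1) (rank M ∸ 1)))))
  where
  f₂<r+j : f M 2 < rank M ℕ.+ j
  f₂<r+j = +m-+n<+o⇒m<n+o (f M 2) (rank M) j j>f₂-r
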